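{- Let $C$ and $C'$ be Euler systems of a 4-regular graph $F$ that respect the same edge directions, and consider arbitrary signed versions of $C$ and $C'$. Then there is a matrix $\Delta$ such that: (1) every diagonal entry of $\Delta$ is $\pm1$ and every other entry is $0$; (2) $M_{\mathbb{R}}^0(C',C)=\Delta\cdot M_{\mathbb{R}}^0(C,C')^{ -1}\cdot\Delta$; (3) if $P$ is any circuit partition of $F$ that respects the same edge directions as $C$ and $C'$, then $M_{\mathbb{R}}^0(C',P)=M_{\mathbb{R}}^0(C',C)\cdot\Delta\cdot M_{\mathbb{R}}^0(C,P)\cdot\Delta$.
   Context: Graphs are finite multigraphs (loops, parallel edges allowed); each edge has two half-edges; $F$ is 4-regular if each vertex is incident on four half-edges. A circuit is a closed walk (with a direction, up to cyclic shift) using no edge twice; an Euler system of $F$ is a set of circuits, one per connected component, using each edge exactly once; a circuit partition is a partition of $E(F)$ into edge-disjoint circuits (Euler systems are circuit partitions). A circuit partition determines at each vertex $v$ its transition $P(v)$: the partition of the four half-edges at $v$ into the two pairs with which its circuits pass through $v$. Two circuit partitions respect the same edge directions if their circuits can be oriented so that every edge is traversed in the same direction by both; the circuits of $C'$ and $P$ are oriented in this way relative to $C$. A signed version of an Euler system $C$ designates, for each vertex $v$, one passage of $C$ through $v$ as $v^{+}$ and the other as $v^{ - }$. Write $v^{+}$ as $h^1_v,v,h^2_v$ and $v^{ - }$ as $h^3_v,v,h^4_v$. Transitions: $\phi_C(v)=\{\{h^1_v,h^2_v\},\{h^3_v,h^4_v\}\}$, $\chi_C(v)=\{\{h^1_v,h^4_v\},\{h^2_v,h^3_v\}\}$,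 $\psi_C(v)=\{\{h^1_v,h^3_v\},\{h^2_v,h^4_v\}\}$. A circuit partition respecting the edge directions of $C$ has $P(x)\neq\psi_C(x)$ for all $x$. $\mathcal{I}_{\mathbb{R}}(C)$ is the $V(F)\times V(F)$ matrix with zero diagonal whose $vw$ entry ($v\neq w$) is $1$ if $v,w$ appear on a circuit of $C$ in cyclic order $v^{+}w^{ - }v^{ - }w^{+}$, $-1$ if in cyclic order $v^{+}w^{+}v^{ - }w^{ - }$, and $0$ otherwise. For a circuit partition $P$ with $P(x)\neq\psi_C(x)$ for all $x$, $M_{\mathbb{R}}^0(C,P)$ is the $V(F)\times V(F)$ integer matrix whose $w$ column is the standard unit vector at $w$ if $P(w)=\phi_C(w)$, and the $w$ column of $\mathcal{I}_{\mathbb{R}}(C)$ if $P(w)=\chi_C(w)$. -}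

module Defs where

open import Function using (_∘_)
open import Data.Nat as ℕ using (ℕ; zero; suc; s≤s)
open import Data.Fin as Fin using (Fin; zero; suc; toℕ; fromℕ<)
open import Data.Fin.Properties using (all?)
open import Data.Bool using (Bool; true; false; not; if_then_else_)
open import Data.Bool.Properties using () renaming (_≟_ to _≟B_)
open import Data.Product using (Σ; ∃; _×_; _,_; proj₁; proj₂)
open import Data.Product.Properties using (≡-dec)
open import Data.Sum using (_⊎_)
open import Data.List using (List; []; _∷_; length; filter; concatMap; allFin)
open import Data.Integer using (ℤ; _+_; _*_; 0ℤ; 1ℤ; -1ℤ)
open import Relation.Binary.PropositionalEquality using (_≡_; _≢_)
open import Relation.Nullary using (Dec; yes; no; does; ¬_)
open import Relation.Nullary.Decidable using (_×-dec_; _⊎-dec_; map′)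

-- A graph with n vertices and m edges; edge e has two half-edges
-- (e , false) and (e , true); `endpoint e b` is the vertex on which the
-- half-edge (e , b) is incident.  Loops and parallel edges are allowed.

record Graph (n m : ℕ) : Set where
  field
    endpoint : Fin m → Bool → Fin n

HalfEdge : ℕ → Set
HalfEdge m = Fin m × Bool

_≟H_ : ∀ {m} (h k : HalfEdge m) → Dec (h ≡ k)
_≟H_ = ≡-dec Fin._≟_ _≟B_

module _ {n m : ℕ} (G : Graph n m) where
  open Graph G

  end : HalfEdge m → Fin n
  end (e , b) = endpoint e b

  allHalfEdges : List (HalfEdge m)
  allHalfEdges = concatMap (λ e → (e , false) ∷ (e , true) ∷ []) (allFin m)

  FourRegular : Set
  FourRegular = ∀ v → length (filter (λ h → end h Fin.≟ v) allHalfEdges) ≡ 4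

  data Connected : Fin n → Fin n → Set where
    here  : ∀ {v} → Connected v v
    there : ∀ {u v w} (e : Fin m) (b : Bool) → Connected u v →
            end (e , b) ≡ v → end (e , not b) ≡ w → Connected u w

Step : ℕ → Set
Step m = Fin m × Bool

depart arrive : ∀ {m} → Step m → HalfEdge m
depart (e , b) = (e , b)
arrive (e , b) = (e , not b)

next : ∀ {k} → Fin (suc k) → Fin (suc k)
next {k} i with toℕ i ℕ.<? k
... | yes p = fromℕ< (s≤s p)
... | no _  = zero

-- A (directed) closed walk of length suc len, given up to cyclic shift
-- by a chosen starting step.  "No edge used twice" is imposed in
-- IsCircuitPartition (each edge occurs at exactly one step overall).
record Circuit {n m : ℕ} (G : Graph n m) : Set where
  field
    len    : ℕ
    step   : Fin (suc len) → Step m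
    closed : ∀ j → end G (arrive (step j)) ≡ end G (depart (step (next j)))

record Circuits {n m : ℕ} (G : Graph n m) : Set where
  field
    count : ℕ
    circ  : Fin count → Circuit G

module _ {n m : ℕ} {G : Graph n m} (P : Circuits G) where
  open Circuits P

  Pos : Set
  Pos = Σ (Fin count) (λ i → Fin (suc (Circuit.len (circ i))))

  stepAt : Pos → Step m
  stepAt (i , j) = Circuit.step (circ i) j

  edgeAt : Pos → Fin m
  edgeAt p = proj₁ (stepAt p)

  dirAt : Pos → Bool
  dirAt p = proj₂ (stepAt p)

  nextPos : Pos → Pos
  nextPos (i , j) = (i , next j)

  inHalf outHalf : Pos → HalfEdge m
  inHalf p  = arrive (stepAt p)
  outHalf p = depart (stepAt (nextPos p))

  passVertex : Pos → Fin n
  passVertex p = end G (inHalf p)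

  decAllPos : {Q : Pos → Set} → (∀ p → Dec (Q p)) → Dec (∀ p → Q p)
  decAllPos {Q} d =
    map′ (λ f p → f (proj₁ p) (proj₂ p)) (λ f i j → f (i , j))
         (all? (λ i → all? (λ j → d (i , j))))

record IsCircuitPartition {n m : ℕ} {G : Graph n m} (P : Circuits G) : Set where
  field
    covers : ∀ e → ∃ λ p → edgeAt P p ≡ e
    once   : ∀ p q → edgeAt P p ≡ edgeAt P q → p ≡ q

record CircuitPartition {n m : ℕ} (G : Graph n m) : Set where
  field
    circuits : Circuits G
    isCP     : IsCircuitPartition circuits

open CircuitPartition public using (circuits)

-- Euler system: a circuit partition with one circuit per connected
-- component (4-regularity of F guarantees every component has edges,
-- hence contains a circuit; here: no two distinct circuits lie in the
-- same component).
record EulerSystem {n m : ℕ} (G : Graph n m) : Set where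
  field
    partition : CircuitPartition G
  open Circuits (circuits partition)
  field
    onePerComponent : ∀ i j →
      Connected G (passVertex (circuits partition) (i , zero))
                  (passVertex (circuits partition) (j , zero)) → i ≡ j

open EulerSystem public using (partition)

circs : ∀ {n m} {G : Graph n m} → EulerSystem G → Circuits G
circs C = circuits (partition C)

SameDirections : ∀ {n m} {G : Graph n m} → Circuits G → Circuits G → Set
SameDirections P Q = ∀ p q → edgeAt P p ≡ edgeAt Q q → dirAt P p ≡ dirAt Q q

-- Signed versions of an Euler system: for each vertex v the two
-- passages v⁺ and v⁻ (distinct passages through v).

record Signing {n m : ℕ} {G : Graph n m} (C : EulerSystem G) : Set where
  field
    plus minus : Fin n → Pos (circs C)
    plus-at    : ∀ v → passVertex (circs C) (plus v) ≡ v
    minus-at   : ∀ v → passVertex (circs C) (minus v) ≡ v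
    distinct   : ∀ v → plus v ≢ minus v

-- a transition: partition of the four half-edges into two pairs
Pair : ℕ → Set
Pair m = HalfEdge m × HalfEdge m

Transition : ℕ → Set
Transition m = Pair m × Pair m

SamePair : ∀ {m} → Pair m → Pair m → Set
SamePair (a , b) (c , d) = (a ≡ c × b ≡ d) ⊎ (a ≡ d × b ≡ c)

samePair? : ∀ {m} (x y : Pair m) → Dec (SamePair x y)
samePair? (a , b) (c , d) = ((a ≟H c) ×-dec (b ≟H d)) ⊎-dec ((a ≟H d) ×-dec (b ≟H c))

module _ {n m : ℕ} {G : Graph n m} {C : EulerSystem G} (s : Signing C) where
  open Signing s
  h1 h2 h3 h4 : Fin n → HalfEdge m
  h1 v = inHalf  (circs C) (plus v)
  h2 v = outHalf (circs C) (plus v)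
  h3 v = inHalf  (circs C) (minus v)
  h4 v = outHalf (circs C) (minus v)

  φ χ ψ : Fin n → Transition m
  φ v = ((h1 v , h2 v) , (h3 v , h4 v))
  χ v = ((h1 v , h4 v) , (h2 v , h3 v))
  ψ v = ((h1 v , h3 v) , (h2 v , h4 v))

-- P(v) = T : every passage of P through v pairs its two half-edges as
-- one of the two pairs of T
TransitionIs : ∀ {n m} {G : Graph n m} → Circuits G → Fin n → Transition m → Set
TransitionIs P v (A , B) =
  ∀ p → passVertex P p ≡ v →
    SamePair (inHalf P p , outHalf P p) A ⊎ SamePair (inHalf P p , outHalf P p) B

transitionIs? : ∀ {n m} {G : Graph n m} (P : Circuits G) v T → Dec (TransitionIs P v T)
transitionIs? P v (A , B) =
  decAllPos P (λ p → (passVertex P p Fin.≟ v) →-dec'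
     (samePair? (inHalf P p , outHalf P p) A ⊎-dec samePair? (inHalf P p , outHalf P p) B))
  where
    open import Relation.Nullary.Decidable using () renaming (_→-dec_ to _→-dec'_)

Mat : ℕ → Set
Mat n = Fin n → Fin n → ℤ

∑ : ∀ {n} → (Fin n → ℤ) → ℤ
∑ {zero}  f = 0ℤ
∑ {suc n} f = f zero + ∑ (f ∘ suc)

infixl 7 _·_
_·_ : ∀ {n} → Mat n → Mat n → Mat n
(A · B) i j = ∑ (λ k → A i k * B k j)

idM : ∀ {n} → Mat n
idM i j = if does (i Fin.≟ j) then 1ℤ else 0ℤ

infix 4 _≈M_
_≈M_ : ∀ {n} → Mat n → Mat n → Set
A ≈M B = ∀ i j → A i j ≡ B i j

IsInverse : ∀ {n} → Mat n → Mat n → Set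
IsInverse N M = (N · M ≈M idM) × (M · N ≈M idM)

IsSignDiagonal : ∀ {n} → Mat n → Set
IsSignDiagonal Δ = (∀ i → Δ i i ≡ 1ℤ ⊎ Δ i i ≡ -1ℤ) × (∀ i j → i ≢ j → Δ i j ≡ 0ℤ)

Rot4 : ℕ → ℕ → ℕ → ℕ → Set
Rot4 x y z u = (x ℕ.< y × y ℕ.< z × z ℕ.< u) ⊎ (y ℕ.< z × z ℕ.< u × u ℕ.< x)
             ⊎ (z ℕ.< u × u ℕ.< x × x ℕ.< y) ⊎ (u ℕ.< x × x ℕ.< y × y ℕ.< z)

rot4? : ∀ x y z u → Dec (Rot4 x y z u)
rot4? x y z u =
  ((x ℕ.<? y) ×-dec (y ℕ.<? z) ×-dec (z ℕ.<? u)) ⊎-dec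
  ((y ℕ.<? z) ×-dec (z ℕ.<? u) ×-dec (u ℕ.<? x)) ⊎-dec
  ((z ℕ.<? u) ×-dec (u ℕ.<? x) ×-dec (x ℕ.<? y)) ⊎-dec
  ((u ℕ.<? x) ×-dec (x ℕ.<? y) ×-dec (y ℕ.<? z))

module _ {n m : ℕ} {G : Graph n m} (P : Circuits G) where
  CyclicOrder : Pos P → Pos P → Pos P → Pos P → Set
  CyclicOrder (i , a) (j , b) (k , c) (l , d) =
    i ≡ j × i ≡ k × i ≡ l × Rot4 (toℕ a) (toℕ b) (toℕ c) (toℕ d)

  cyclicOrder? : ∀ a b c d → Dec (CyclicOrder a b c d)
  cyclicOrder? (i , a) (j , b) (k , c) (l , d) =
    (i Fin.≟ j) ×-dec (i Fin.≟ k) ×-dec (i Fin.≟ l) ×-dec rot4? (toℕ a) (toℕ b) (toℕ c) (toℕ d)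

module _ {n m : ℕ} {G : Graph n m} {C : EulerSystem G} (s : Signing C) where
  open Signing s

  interlace : Mat n
  interlace v w =
    if does (v Fin.≟ w) then 0ℤ
    else if does (cyclicOrder? (circs C) (plus v) (minus w) (minus v) (plus w)) then 1ℤ
    else if does (cyclicOrder? (circs C) (plus v) (plus w) (minus v) (minus w)) then -1ℤ
    else 0ℤ

  -- column w is the unit vector at w if P(w) = φ_C(w), and the w column of
  -- I_ℝ(C) otherwise (i.e. if P(w) = χ_C(w), as P(w) ≠ ψ_C(w) for the P used)
  M0 : Circuits G → Mat n
  M0 P v w =
    if does (transitionIs? P w (φ s w)) then idM v w else interlace v w

module Submission where

-- Corollary 21.  For a signed Euler system A let σ_v : E(F) → {0,1} indicate the edges of A's
-- circuit after v⁺ up to v⁻, and let e1 w , e2 w (e3 w , e4 w) be the edges entering and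
-- leaving w at w⁺ (w⁻).  Cyclic-order bookkeeping gives σ_v(e1 w) − σ_v(e2 w) = −[v = w],
-- σ_v(e3 w) − σ_v(e4 w) = [v = w] and σ_v(e1 w) − σ_v(e4 w) = −I_ℝ(A)_{vw}; hence
-- M⁰(A,Q)_{vw} = −(σ_v(e1 w) − σ_v(x w)), x w being the edge on which Q leaves w after
-- entering along e1 w.  A balanced z : E → ℤ (inflow = outflow at each vertex), such as a
-- segment indicator of a second system B, has the potential z + Σ_v (z(e1 v) − z(e2 v)) σ_v,
-- constant along A's circuits; this writes z(e1 w) − z(x w) through the σ_v.  With a sign δ_w
-- recording whether the signings of A and B agree at w, it yields the main identity
-- M⁰(B,Q) = M⁰(B,A) Δ M⁰(A,Q) Δ, while M⁰(A,A) = I, and the corollary follows by a general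
-- matrix lemma.

open import Defs
open import Function using (_∘_; Equivalence)
open import Data.Nat as ℕ using (ℕ; zero; suc; s≤s; _<ᵇ_; _≤ᵇ_)
import Data.Nat.Properties as ℕP
open import Data.Fin as Fin using (Fin; zero; suc; toℕ; fromℕ<; punchIn)
open import Data.Fin.Properties
  using (toℕ-injective; toℕ-fromℕ<; fromℕ<-toℕ; toℕ<n; any?; pigeonhole; punchInᵢ≢i)
open import Data.Bool using (Bool; true; false; not; T; _∧_; _∨_; if_then_else_)
open import Data.Bool.Properties using (not-involutive; not-¬; ∧-zeroʳ; T-≡)
open import Data.Product using (Σ; ∃; _×_; _,_; proj₁; proj₂)
open import Data.Product.Properties using (Σ-≡,≡←≡)
open import Data.Sum using (_⊎_; inj₁; inj₂)
open import Data.Empty using (⊥; ⊥-elim)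
open import Data.Vec.Functional using ([]; _∷_; replicate)
open import Data.List as List using (List; lookup; filter)
open import Data.List.Relation.Unary.Any as Any using (here; there; index)
open import Data.List.Relation.Unary.Any.Properties using (lookup-index)
open import Data.List.Membership.Propositional using (_∈_)
open import Data.List.Membership.Propositional.Properties using (∈-filter⁺; ∈-concatMap⁺; ∈-allFin)
open import Data.Integer as ℤ using (ℤ; 0ℤ; 1ℤ; -1ℤ; _+_; _*_; _-_; -_)
import Data.Integer.Properties as ℤP
open import Data.Integer.Tactic.RingSolver using (solve-∀)
open import Algebra.Properties.AbelianGroup ℤP.+-0-abelianGroup using (inverseʳ-unique)
open import Algebra.Properties.Semiring.Sum ℤP.+-*-semiring
  using (sum; sum-cong-≗; ∑-distrib-+; *-distribˡ-sum; *-distribʳ-sum; sum-remove; sum-replicate-zero)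
open import Relation.Binary.Definitions using (tri<; tri≈; tri>)
open import Relation.Binary.PropositionalEquality
open import Relation.Nullary using (¬_; Dec; yes; no; does)
open import Relation.Nullary.Decidable using (dec-true; dec-false)

next-suc : ∀ {L} (i : Fin (suc L)) → toℕ i ℕ.< L → toℕ (next i) ≡ suc (toℕ i)
next-suc {L} i i<L with toℕ i ℕ.<? L
... | yes p = toℕ-fromℕ< (s≤s p)
... | no ¬p = ⊥-elim (¬p i<L)

next-wrap : ∀ {L} (i : Fin (suc L)) → ¬ toℕ i ℕ.< L → next i ≡ zero
next-wrap {L} i i≮L with toℕ i ℕ.<? L
... | yes p = ⊥-elim (i≮L p)
... | no _  = refl

toℕ-last : ∀ {L} (i : Fin (suc L)) → ¬ toℕ i ℕ.< L → toℕ i ≡ L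
toℕ-last i i≮L = ℕP.≤-antisym (ℕP.<⇒≤pred (toℕ<n i)) (ℕP.≮⇒≥ i≮L)

next-injective : ∀ {L} (i j : Fin (suc L)) → next i ≡ next j → i ≡ j
next-injective {L} i j eq = by-cases (toℕ i ℕ.<? L) (toℕ j ℕ.<? L)
  where
  open ≡-Reasoning
  by-cases : Dec (toℕ i ℕ.< L) → Dec (toℕ j ℕ.< L) → i ≡ j
  by-cases (yes i<L) (yes j<L) = toℕ-injective (ℕP.suc-injective (begin
    suc (toℕ i)  ≡⟨ next-suc i i<L ⟨
    toℕ (next i) ≡⟨ cong toℕ eq ⟩
    toℕ (next j) ≡⟨ next-suc j j<L ⟩
    suc (toℕ j)  ∎))
  by-cases (yes i<L) (no j≮L) =
    ⊥-elim (ℕP.1+n≢0 (trans (sym (next-suc i i<L)) (cong toℕ (trans eq (next-wrap j j≮L)))))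
  by-cases (no i≮L) (yes j<L) =
    ⊥-elim (ℕP.1+n≢0 (trans (sym (next-suc j j<L)) (cong toℕ (trans (sym eq) (next-wrap i i≮L)))))
  by-cases (no i≮L) (no j≮L) = toℕ-injective (trans (toℕ-last i i≮L) (sym (toℕ-last j j≮L)))

next-induction : ∀ {L} (Q : Fin (suc L) → Set) → Q zero → (∀ j → Q j → Q (next j)) → ∀ j → Q j
next-induction {L} Q base step j =
  subst Q (fromℕ<-toℕ j (toℕ<n j)) (go (toℕ j) (toℕ<n j))
  where
  go : ∀ k (k<1+L : k ℕ.< suc L) → Q (fromℕ< k<1+L)
  go zero    _      = base
  go (suc k) k+1<1+L = subst Q next-k (step _ (go k k<1+L))
    where
    k<1+L : k ℕ.< suc L
    k<1+L = ℕP.<-trans (ℕP.n<1+n k) k+1<1+L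
    next-k : next (fromℕ< k<1+L) ≡ fromℕ< k+1<1+L
    next-k = toℕ-injective (begin
      toℕ (next (fromℕ< k<1+L)) ≡⟨ next-suc _ (subst (ℕ._< L) (sym (toℕ-fromℕ< k<1+L)) (ℕP.≤-pred k+1<1+L)) ⟩
      suc (toℕ (fromℕ< k<1+L))  ≡⟨ cong suc (toℕ-fromℕ< k<1+L) ⟩
      suc k                     ≡⟨ toℕ-fromℕ< k+1<1+L ⟨
      toℕ (fromℕ< k+1<1+L)      ∎)
      where open ≡-Reasoning

module _ {n m : ℕ} {F : Graph n m} (P : Circuits F) where

  nextPos-injective : ∀ p q → nextPos P p ≡ nextPos P q → p ≡ q
  nextPos-injective (i , a) (j , b) eq with Σ-≡,≡←≡ eq
  ... | refl , a≡b with next-injective a b a≡b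
  ... | refl = refl

  outHalf-end : ∀ p → end F (outHalf P p) ≡ passVertex P p
  outHalf-end (i , j) = sym (Circuit.closed (Circuits.circ P i) j)

  connected-along-circuit : ∀ i j → Connected F (passVertex P (i , zero)) (passVertex P (i , j))
  connected-along-circuit i = next-induction _ here
    (λ j c → there (edgeAt P (i , next j)) (dirAt P (i , next j)) c (outHalf-end (i , j)) refl)

  constant-on-circuit : {X : Set} (f : Pos P → X) → (∀ p → f (nextPos P p) ≡ f p) →
    ∀ p q → proj₁ p ≡ proj₁ q → f p ≡ f q
  constant-on-circuit f invariant (i , a) (.i , b) refl = trans (from-start a) (sym (from-start b))
    where
    from-start : ∀ j → f (i , j) ≡ f (i , zero)
    from-start = next-induction _ refl (λ j e → trans (invariant (i , j)) e)

module _ {n m : ℕ} (F : Graph n m) where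

  connected-trans : ∀ {u v w} → Connected F u v → Connected F v w → Connected F u w
  connected-trans c here              = c
  connected-trans c (there e b d p q) = there e b (connected-trans c d) p q

  connected-sym : ∀ {u v} → Connected F u v → Connected F v u
  connected-sym here              = here
  connected-sym (there e b c p q) =
    connected-trans (there e (not b) here q (trans (cong (λ x → end F (e , x)) (not-involutive b)) p))
                    (connected-sym c)

module _ {n m : ℕ} {F : Graph n m} (P : Circuits F) (cp : IsCircuitPartition P) where
  open IsCircuitPartition cp

  positionOf : Fin m → Pos P
  positionOf e = proj₁ (covers e)

  positionOf-edgeAt : ∀ p → positionOf (edgeAt P p) ≡ p
  positionOf-edgeAt p = once _ p (proj₂ (covers (edgeAt P p)))

  sameDirections-refl : SameDirections P P
  sameDirections-refl p q eq = cong (dirAt P) (once p q eq)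

sameDirections-sym : ∀ {n m} {F : Graph n m} {X Y : Circuits F} →
  SameDirections X Y → SameDirections Y X
sameDirections-sym sd p q eq = sym (sd q p (sym eq))

arrive≢depart : ∀ {n m} {F : Graph n m} (X Y : Circuits F) → SameDirections X Y →
  ∀ p q → arrive (stepAt X p) ≢ depart (stepAt Y q)
arrive≢depart X Y sd p q eq = not-¬ refl (trans (sd p q (cong proj₁ eq)) (sym (cong proj₂ eq)))

-- The entries of a finite family are pairwise distinct (checked on ordered index pairs,
-- which is what the pigeonhole principle of the library delivers).
PairwiseDistinct : ∀ {k} {A : Set} → (Fin k → A) → Set
PairwiseDistinct f = ∀ {i j} → i Fin.< j → f i ≢ f j

distinct-[] : ∀ {A : Set} → PairwiseDistinct {A = A} []
distinct-[] {i = ()}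

distinct-∷ : ∀ {k} {A : Set} {x : A} {f : Fin k → A} →
  (∀ j → x ≢ f j) → PairwiseDistinct f → PairwiseDistinct (x ∷ f)
distinct-∷ x∉f f-distinct {zero}  {suc j} _         = x∉f j
distinct-∷ x∉f f-distinct {suc i} {suc j} (s≤s i<j) = f-distinct i<j

module Incidence {n m : ℕ} (F : Graph n m) (reg : FourRegular F) where

  ∈-allHalfEdges : (h : HalfEdge m) → h ∈ allHalfEdges F
  ∈-allHalfEdges (e , b) = ∈-concatMap⁺ (λ e → (e , false) List.∷ (e , true) List.∷ List.[]) (Any.map (pick b) (∈-allFin e))
    where
    pick : ∀ b {e′} → e ≡ e′ → (e , b) ∈ (e′ , false) List.∷ (e′ , true) List.∷ List.[]
    pick false refl = here refl
    pick true  refl = there (here refl)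

  -- At most four pairwise distinct half-edges are incident with a vertex (pigeonhole into
  -- the filtered list of all half-edges at w, which has length 4).
  incident-bound : ∀ {k} w (f : Fin k → HalfEdge m) → (∀ i → end F (f i) ≡ w) →
    PairwiseDistinct f → k ℕ.≤ 4
  incident-bound {k} w f at distinct = ℕP.≮⇒≥ collision
    where
    incident : List (HalfEdge m)
    incident = filter (λ h → end F h Fin.≟ w) (allHalfEdges F)
    listed : ∀ i → f i ∈ incident
    listed i = ∈-filter⁺ (λ h → end F h Fin.≟ w) (∈-allHalfEdges (f i)) (at i)
    collision : 4 ℕ.< k → ⊥
    collision 4<k with pigeonhole (subst (ℕ._< k) (sym (reg w)) 4<k) (index ∘ listed)
    ... | i , j , i<j , same = distinct i<j
      (trans (lookup-index (listed i)) (trans (cong (lookup incident) same) (sym (lookup-index (listed j)))))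

  exhaust : ∀ w (f : Fin 4 → HalfEdge m) → (∀ i → end F (f i) ≡ w) → PairwiseDistinct f →
    ∀ h → end F h ≡ w → ∃ λ i → h ≡ f i
  exhaust w f at distinct h h-at with any? (λ i → h ≟H f i)
  ... | yes found = found
  ... | no  new   = ⊥-elim (ℕP.<-irrefl refl
    (incident-bound w (h ∷ f) (λ { zero → h-at ; (suc i) → at i }) (distinct-∷ (λ j e → new (j , e)) distinct)))

module Signed {n m : ℕ} (F : Graph n m) (reg : FourRegular F) (A : EulerSystem F) (s : Signing A) where
  open Signing s
  open Incidence F reg

  P : Circuits F
  P = circs A

  cpA : IsCircuitPartition P
  cpA = CircuitPartition.isCP (partition A)

  open IsCircuitPartition cpA

  -- v⁺ and v⁻ lie on the same circuit, since an Euler system has one circuit per component.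
  plus-minus-same-circuit : ∀ v → proj₁ (plus v) ≡ proj₁ (minus v)
  plus-minus-same-circuit v = EulerSystem.onePerComponent A _ _
    (connected-trans F (reach (plus v) (plus-at v)) (connected-sym F (reach (minus v) (minus-at v))))
    where
    reach : ∀ p → passVertex P p ≡ v → Connected F (passVertex P (proj₁ p , zero)) v
    reach (i , j) at = subst (Connected F _) at (connected-along-circuit P i j)

  e1 e2 e3 e4 : Fin n → Fin m
  e1 v = edgeAt P (plus v)
  e2 v = edgeAt P (nextPos P (plus v))
  e3 v = edgeAt P (minus v)
  e4 v = edgeAt P (nextPos P (minus v))

  corners : Fin n → Fin 4 → HalfEdge m
  corners w = h1 s w ∷ h2 s w ∷ h3 s w ∷ h4 s w ∷ []

  corners-at : ∀ w i → end F (corners w i) ≡ w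
  corners-at w zero                   = plus-at w
  corners-at w (suc zero)             = trans (outHalf-end P (plus w)) (plus-at w)
  corners-at w (suc (suc zero))       = minus-at w
  corners-at w (suc (suc (suc zero))) = trans (outHalf-end P (minus w)) (minus-at w)

  h1≢h3 : ∀ v → h1 s v ≢ h3 s v
  h1≢h3 v eq = distinct v (once _ _ (cong proj₁ eq))

  h2≢h4 : ∀ v → h2 s v ≢ h4 s v
  h2≢h4 v eq = distinct v (nextPos-injective P _ _ (once _ _ (cong proj₁ eq)))

  -- They are distinct: arrivals differ from departures, and the passages v⁺ ≠ v⁻ use different edges.
  corners-distinct : ∀ w → PairwiseDistinct (corners w)
  corners-distinct w =
    distinct-∷ (λ { zero → in≢out ; (suc zero) → h1≢h3 w ; (suc (suc zero)) → in≢out })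
    (distinct-∷ (λ { zero → λ e → in≢out (sym e) ; (suc zero) → h2≢h4 w })
    (distinct-∷ (λ { zero → in≢out })
    (distinct-∷ (λ ()) distinct-[])))
    where
    in≢out : ∀ {p q} → inHalf P p ≢ outHalf P q
    in≢out = arrive≢depart P P (sameDirections-refl P cpA) _ _

  arrival-corner : (Y : Circuits F) → SameDirections Y P → ∀ w p → passVertex Y p ≡ w →
    inHalf Y p ≡ h1 s w ⊎ inHalf Y p ≡ h3 s w
  arrival-corner Y sd w p at with exhaust w (corners w) (corners-at w) (corners-distinct w) _ at
  ... | zero , eq                   = inj₁ eq
  ... | suc zero , eq               = ⊥-elim (arrive≢depart Y P sd _ _ eq)
  ... | suc (suc zero) , eq         = inj₂ eq
  ... | suc (suc (suc zero)) , eq   = ⊥-elim (arrive≢depart Y P sd _ _ eq)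

  departure-corner : (Y : Circuits F) → SameDirections P Y → ∀ w q → passVertex Y q ≡ w →
    outHalf Y q ≡ h2 s w ⊎ outHalf Y q ≡ h4 s w
  departure-corner Y sd w q at
    with exhaust w (corners w) (corners-at w) (corners-distinct w) _ (trans (outHalf-end Y q) at)
  ... | zero , eq                   = ⊥-elim (arrive≢depart P Y sd _ _ (sym eq))
  ... | suc zero , eq               = inj₁ eq
  ... | suc (suc zero) , eq         = ⊥-elim (arrive≢depart P Y sd _ _ (sym eq))
  ... | suc (suc (suc zero)) , eq   = inj₂ eq

  passages : ∀ w p → passVertex P p ≡ w → p ≡ plus w ⊎ p ≡ minus w
  passages w p at with arrival-corner P (sameDirections-refl P cpA) w p at
  ... | inj₁ eq = inj₁ (once _ _ (cong proj₁ eq))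
  ... | inj₂ eq = inj₂ (once _ _ (cong proj₁ eq))

<ᵇ-true : ∀ {x y} → x ℕ.< y → (x <ᵇ y) ≡ true
<ᵇ-true x<y = Equivalence.to T-≡ (ℕP.<⇒<ᵇ x<y)

<ᵇ-false : ∀ {x y} → ¬ x ℕ.< y → (x <ᵇ y) ≡ false
<ᵇ-false {x} {y} x≮y with x <ᵇ y in eq
... | true  = ⊥-elim (x≮y (ℕP.<ᵇ⇒< x y (Equivalence.from T-≡ eq)))
... | false = refl

≤ᵇ-true : ∀ {x y} → x ℕ.≤ y → (x ≤ᵇ y) ≡ true
≤ᵇ-true x≤y = Equivalence.to T-≡ (ℕP.≤⇒≤ᵇ x≤y)

≤ᵇ-false : ∀ {x y} → ¬ x ℕ.≤ y → (x ≤ᵇ y) ≡ false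
≤ᵇ-false {x} {y} x≰y with x ≤ᵇ y in eq
... | true  = ⊥-elim (x≰y (ℕP.≤ᵇ⇒≤ x y (Equivalence.from T-≡ eq)))
... | false = refl

<ᵇ-suc : ∀ x c → x ≢ c → (x <ᵇ suc c) ≡ (x <ᵇ c)
<ᵇ-suc x c x≢c with ℕP.<-cmp x c
... | tri< x<c _ _ rewrite <ᵇ-true x<c | <ᵇ-true (ℕP.m<n⇒m<1+n x<c) = refl
... | tri≈ _ x≡c _ = ⊥-elim (x≢c x≡c)
... | tri> _ _ c<x rewrite <ᵇ-false (ℕP.<⇒≯ c<x) | <ᵇ-false {x} {suc c} (λ x<1+c → ℕP.<⇒≱ c<x (ℕP.≤-pred x<1+c)) = refl

≤ᵇ-as-<ᵇ : ∀ c b → c ≢ b → (c ≤ᵇ b) ≡ (c <ᵇ b)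
≤ᵇ-as-<ᵇ c b c≢b with ℕP.<-cmp c b
... | tri< c<b _ _ rewrite <ᵇ-true c<b | ≤ᵇ-true (ℕP.<⇒≤ c<b) = refl
... | tri≈ _ c≡b _ = ⊥-elim (c≢b c≡b)
... | tri> _ _ b<c rewrite <ᵇ-false (ℕP.<⇒≯ b<c) | ≤ᵇ-false (ℕP.<⇒≱ b<c) = refl

toℕ-≢ : ∀ {k} {a b : Fin k} → a ≢ b → toℕ a ≢ toℕ b
toℕ-≢ a≢b eq = a≢b (toℕ-injective eq)

<ᵇ-flip : ∀ x y → x ≢ y → (y <ᵇ x) ≡ not (x <ᵇ y)
<ᵇ-flip x y x≢y with ℕP.<-cmp x y
... | tri< x<y _ _ rewrite <ᵇ-true x<y | <ᵇ-false (ℕP.<⇒≯ x<y) = refl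
... | tri≈ _ x≡y _ = ⊥-elim (x≢y x≡y)
... | tri> _ _ y<x rewrite <ᵇ-true y<x | <ᵇ-false (ℕP.<⇒≯ y<x) = refl

from-<ᵇ : ∀ {x y} → (x <ᵇ y) ≡ true → x ℕ.< y
from-<ᵇ {x} {y} eq = ℕP.<ᵇ⇒< x y (Equivalence.from T-≡ eq)

from-≮ᵇ : ∀ {x y} → (x <ᵇ y) ≡ false → y ℕ.≤ x
from-≮ᵇ eq = ℕP.≮⇒≥ (λ x<y → subst T eq (ℕP.<⇒<ᵇ x<y))

<ᵇ-trans : ∀ x y z → (x <ᵇ y) ≡ true → (y <ᵇ z) ≡ true → (x <ᵇ z) ≡ true
<ᵇ-trans x y z x<y y<z = <ᵇ-true (ℕP.<-trans (from-<ᵇ {x} {y} x<y) (from-<ᵇ {y} {z} y<z))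

≮ᵇ-trans : ∀ x y z → (x <ᵇ y) ≡ false → (y <ᵇ z) ≡ false → (x <ᵇ z) ≡ false
≮ᵇ-trans x y z x≮y y≮z = <ᵇ-false (ℕP.≤⇒≯ (ℕP.≤-trans (from-≮ᵇ {y} {z} y≮z) (from-≮ᵇ {x} {y} x≮y)))

-- Membership of x in the cyclic arc (a , b] of positions, computed from the three
-- comparisons a < b, a < x and x ≤ b.
onArc : Bool → Bool → Bool → Bool
onArc a<b a<x x≤b = if a<b then a<x ∧ x≤b else a<x ∨ x≤b

inArc : ℕ → ℕ → ℕ → Bool
inArc a b x = onArc (a <ᵇ b) (a <ᵇ x) (x ≤ᵇ b)

arc-start : ∀ a b → a ≢ b → inArc a b a ≡ false
arc-start a b a≢b rewrite <ᵇ-false (ℕP.n≮n a) with ℕP.<-cmp a b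
... | tri< a<b _ _ rewrite <ᵇ-true a<b = refl
... | tri≈ _ a≡b _ = ⊥-elim (a≢b a≡b)
... | tri> _ _ b<a rewrite <ᵇ-false (ℕP.<⇒≯ b<a) | ≤ᵇ-false (ℕP.<⇒≱ b<a) = refl

arc-end : ∀ a b → inArc a b b ≡ true
arc-end a b rewrite ≤ᵇ-true (ℕP.≤-refl {b}) with a <ᵇ b
... | true  = refl
... | false = refl

module _ {L : ℕ} where

  private
    below-last : (a c : Fin (suc L)) → ¬ toℕ c ℕ.< L → a ≢ c → toℕ a ℕ.< L
    below-last a c c≮L a≢c =
      ℕP.≤∧≢⇒< (ℕP.<⇒≤pred (toℕ<n a)) (λ a≡L → a≢c (toℕ-injective (trans a≡L (sym (toℕ-last c c≮L)))))

  arc-after-start : (a b : Fin (suc L)) → a ≢ b → inArc (toℕ a) (toℕ b) (toℕ (next a)) ≡ true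
  arc-after-start a b a≢b = by-cases (toℕ a ℕ.<? L)
    where
    by-cases : Dec (toℕ a ℕ.< L) → inArc (toℕ a) (toℕ b) (toℕ (next a)) ≡ true
    by-cases (yes a<L) rewrite next-suc a a<L | <ᵇ-true (ℕP.n<1+n (toℕ a)) with toℕ a <ᵇ toℕ b
    ... | true  = refl
    ... | false = refl
    by-cases (no a≮L)
      rewrite next-wrap a a≮L
            | <ᵇ-false {toℕ a} {toℕ b}
                (ℕP.<⇒≯ (subst (toℕ b ℕ.<_) (sym (toℕ-last a a≮L)) (below-last b a a≮L (λ e → a≢b (sym e)))))
      = refl

  arc-after-end : (a b : Fin (suc L)) → a ≢ b → inArc (toℕ a) (toℕ b) (toℕ (next b)) ≡ false
  arc-after-end a b a≢b = by-cases (toℕ b ℕ.<? L)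
    where
    by-cases : Dec (toℕ b ℕ.< L) → inArc (toℕ a) (toℕ b) (toℕ (next b)) ≡ false
    by-cases (yes b<L) rewrite next-suc b b<L | <ᵇ-false (ℕP.n≮n (toℕ b)) with ℕP.<-cmp (toℕ a) (toℕ b)
    ... | tri< a<b _ _ rewrite <ᵇ-true a<b = ∧-zeroʳ _
    ... | tri≈ _ a≡b _ = ⊥-elim (toℕ-≢ a≢b a≡b)
    ... | tri> _ _ b<a
      rewrite <ᵇ-false (ℕP.<⇒≯ b<a) | <ᵇ-false {toℕ a} {suc (toℕ b)} (λ a<1+b → ℕP.<⇒≱ b<a (ℕP.≤-pred a<1+b))
      = refl
    by-cases (no b≮L) rewrite next-wrap b b≮L | toℕ-last b b≮L | <ᵇ-true (below-last a b b≮L a≢b) = refl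

  arc-step : (a b c : Fin (suc L)) → c ≢ a → c ≢ b →
    inArc (toℕ a) (toℕ b) (toℕ (next c)) ≡ inArc (toℕ a) (toℕ b) (toℕ c)
  arc-step a b c c≢a c≢b = by-cases (toℕ c ℕ.<? L)
    where
    by-cases : Dec (toℕ c ℕ.< L) → inArc (toℕ a) (toℕ b) (toℕ (next c)) ≡ inArc (toℕ a) (toℕ b) (toℕ c)
    by-cases (yes c<L)
      rewrite next-suc c c<L | <ᵇ-suc (toℕ a) (toℕ c) (λ e → toℕ-≢ c≢a (sym e)) | ≤ᵇ-as-<ᵇ (toℕ c) (toℕ b) (toℕ-≢ c≢b)
      = refl
    by-cases (no c≮L)
      rewrite next-wrap c c≮L | toℕ-last c c≮L | <ᵇ-true (below-last a c c≮L (λ e → c≢a (sym e)))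
            | ≤ᵇ-false {L} {toℕ b} (ℕP.<⇒≱ (below-last b c c≮L (λ e → c≢b (sym e))))
      with toℕ a <ᵇ toℕ b
    ... | true  = refl
    ... | false = refl

indicator : Bool → ℤ
indicator true  = 1ℤ
indicator false = 0ℤ

-- Boolean form of Rot4: `does (rot4? x y z u)` computes to `rot4B (x <ᵇ y) (y <ᵇ z) (z <ᵇ u) (u <ᵇ x)`.
rot4B : Bool → Bool → Bool → Bool → Bool
rot4B p q r t = (p ∧ (q ∧ r)) ∨ ((q ∧ (r ∧ t)) ∨ ((r ∧ (t ∧ p)) ∨ (t ∧ (p ∧ q))))

-- Truth table behind interlacement, in terms of ab = a<b, ac = a<c, ad = a<d, bc = b<c,
-- bd = b<d; the hypotheses are transitivity of <.  Contradictory rows are discharged.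
interlace-table : ∀ ab ac ad bc bd →
  (ab ≡ true → bc ≡ true → ac ≡ true) → (ab ≡ false → bc ≡ false → ac ≡ false) →
  (ab ≡ true → bd ≡ true → ad ≡ true) → (ab ≡ false → bd ≡ false → ad ≡ false) →
  indicator (onArc ab ac (not bc)) - indicator (onArc ab ad (not bd)) ≡
  - (if rot4B ad (not bd) bc (not ac) then 1ℤ else if rot4B ac (not bc) bd (not ad) then -1ℤ else 0ℤ)
interlace-table true  true  true  true  true  _ _ _ _ = refl
interlace-table true  true  true  true  false _ _ _ _ = refl
interlace-table true  true  true  false true  _ _ _ _ = refl
interlace-table true  true  true  false false _ _ _ _ = refl
interlace-table true  true  false true  true  _ _ t _ = ⊥-elim (not-¬ refl (t refl refl))
interlace-table true  true  false true  false _ _ _ _ = refl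
interlace-table true  true  false false true  _ _ _ _ = refl
interlace-table true  true  false false false _ _ _ _ = refl
interlace-table true  false true  true  true  t _ _ _ = ⊥-elim (not-¬ refl (t refl refl))
interlace-table true  false true  true  false _ _ _ _ = refl
interlace-table true  false true  false true  _ _ _ _ = refl
interlace-table true  false true  false false _ _ _ _ = refl
interlace-table true  false false true  true  _ _ _ _ = refl
interlace-table true  false false true  false t _ _ _ = ⊥-elim (not-¬ refl (t refl refl))
interlace-table true  false false false true  _ _ t _ = ⊥-elim (not-¬ refl (t refl refl))
interlace-table true  false false false false _ _ _ _ = refl
interlace-table false true  true  true  true  _ _ _ _ = refl
interlace-table false true  true  true  false _ _ _ t = ⊥-elim (not-¬ refl (t refl refl))
interlace-table false true  true  false true  _ t _ _ = ⊥-elim (not-¬ refl (t refl refl))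
interlace-table false true  true  false false _ _ _ _ = refl
interlace-table false true  false true  true  _ _ _ _ = refl
interlace-table false true  false true  false _ _ _ _ = refl
interlace-table false true  false false true  _ _ _ _ = refl
interlace-table false true  false false false _ t _ _ = ⊥-elim (not-¬ refl (t refl refl))
interlace-table false false true  true  true  _ _ _ _ = refl
interlace-table false false true  true  false _ _ _ _ = refl
interlace-table false false true  false true  _ _ _ _ = refl
interlace-table false false true  false false _ _ _ t = ⊥-elim (not-¬ refl (t refl refl))
interlace-table false false false true  true  _ _ _ _ = refl
interlace-table false false false true  false _ _ _ _ = refl
interlace-table false false false false true  _ _ _ _ = refl
interlace-table false false false false false _ _ _ _ = refl

arc-interlace : ∀ a b c d → a ≢ b → a ≢ c → a ≢ d → b ≢ c → b ≢ d →
  indicator (inArc a b c) - indicator (inArc a b d) ≡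
  - (if rot4B (a <ᵇ d) (d <ᵇ b) (b <ᵇ c) (c <ᵇ a) then 1ℤ
     else if rot4B (a <ᵇ c) (c <ᵇ b) (b <ᵇ d) (d <ᵇ a) then -1ℤ else 0ℤ)
arc-interlace a b c d a≢b a≢c a≢d b≢c b≢d
  rewrite ≤ᵇ-as-<ᵇ c b (λ e → b≢c (sym e)) | ≤ᵇ-as-<ᵇ d b (λ e → b≢d (sym e))
        | <ᵇ-flip b c b≢c | <ᵇ-flip b d b≢d | <ᵇ-flip a c a≢c | <ᵇ-flip a d a≢d
  = interlace-table (a <ᵇ b) (a <ᵇ c) (a <ᵇ d) (b <ᵇ c) (b <ᵇ d)
      (<ᵇ-trans a b c) (≮ᵇ-trans a b c) (<ᵇ-trans a b d) (≮ᵇ-trans a b d)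

≟-refl : ∀ {k} (i : Fin k) → does (i Fin.≟ i) ≡ true
≟-refl i = dec-true (i Fin.≟ i) refl

module Segments {n m : ℕ} (F : Graph n m) (reg : FourRegular F) (A : EulerSystem F) (s : Signing A) where
  open Signing s
  open Signed F reg A s public

  inStretch : Pos P → Pos P → Pos P → Bool
  inStretch (i , a) (_ , b) (k , c) = does (k Fin.≟ i) ∧ inArc (toℕ a) (toℕ b) (toℕ c)

  stretch-start : ∀ pv mv → proj₁ pv ≡ proj₁ mv → pv ≢ mv → inStretch pv mv pv ≡ false
  stretch-start (i , a) (.i , b) refl ne rewrite arc-start (toℕ a) (toℕ b) (toℕ-≢ (λ e → ne (cong (i ,_) e))) = ∧-zeroʳ _

  stretch-after-start : ∀ pv mv → proj₁ pv ≡ proj₁ mv → pv ≢ mv → inStretch pv mv (nextPos P pv) ≡ true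
  stretch-after-start (i , a) (.i , b) refl ne rewrite ≟-refl i = arc-after-start a b (λ e → ne (cong (i ,_) e))

  stretch-end : ∀ pv mv → proj₁ pv ≡ proj₁ mv → inStretch pv mv mv ≡ true
  stretch-end (i , a) (.i , b) refl rewrite ≟-refl i = arc-end (toℕ a) (toℕ b)

  stretch-after-end : ∀ pv mv → proj₁ pv ≡ proj₁ mv → pv ≢ mv → inStretch pv mv (nextPos P mv) ≡ false
  stretch-after-end (i , a) (.i , b) refl ne rewrite ≟-refl i = arc-after-end a b (λ e → ne (cong (i ,_) e))

  stretch-step : ∀ pv mv p → proj₁ pv ≡ proj₁ mv → p ≢ pv → p ≢ mv →
    inStretch pv mv (nextPos P p) ≡ inStretch pv mv p
  stretch-step (i , a) (.i , b) (k , c) refl p≢pv p≢mv with k Fin.≟ i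
  ... | yes refl = arc-step a b c (λ e → p≢pv (cong (i ,_) e)) (λ e → p≢mv (cong (i ,_) e))
  ... | no _     = refl

  stretch-interlace : ∀ pv mv pw mw → proj₁ pv ≡ proj₁ mv → proj₁ pw ≡ proj₁ mw →
    pv ≢ mv → pv ≢ pw → pv ≢ mw → mv ≢ pw → mv ≢ mw →
    indicator (inStretch pv mv pw) - indicator (inStretch pv mv mw) ≡
    - (if does (cyclicOrder? P pv mw mv pw) then 1ℤ
       else if does (cyclicOrder? P pv pw mv mw) then -1ℤ else 0ℤ)
  stretch-interlace (i , a) (.i , b) (k , c) (.k , d) refl refl a≢b a≢c a≢d b≢c b≢d with k Fin.≟ i
  ... | yes refl rewrite ≟-refl i =
    arc-interlace (toℕ a) (toℕ b) (toℕ c) (toℕ d) (apart a≢b) (apart a≢c) (apart a≢d) (apart b≢c) (apart b≢d)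
    where
    apart : ∀ {x y} → (i , x) ≢ (i , y) → toℕ x ≢ toℕ y
    apart ne = toℕ-≢ (λ e → ne (cong (i ,_) e))
  ... | no k≢i rewrite dec-false (i Fin.≟ k) (λ e → k≢i (sym e)) = refl

  σ : Fin n → Fin m → ℤ
  σ v e = indicator (inStretch (plus v) (minus v) (positionOf P cpA e))

  σ-at : ∀ v p → σ v (edgeAt P p) ≡ indicator (inStretch (plus v) (minus v) p)
  σ-at v p = cong (λ q → indicator (inStretch (plus v) (minus v) q)) (positionOf-edgeAt P cpA p)

  passages-apart : ∀ {v w p q} → v ≢ w → passVertex P p ≡ v → passVertex P q ≡ w → p ≢ q
  passages-apart v≢w p-at q-at p≡q = v≢w (trans (sym p-at) (trans (cong (passVertex P) p≡q) q-at))

  σ-plus-step : ∀ v w → σ v (e1 w) - σ v (e2 w) ≡ - idM v w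
  σ-plus-step v w rewrite σ-at v (plus w) | σ-at v (nextPos P (plus w)) with v Fin.≟ w
  ... | yes refl rewrite stretch-start (plus v) (minus v) (plus-minus-same-circuit v) (distinct v)
                       | stretch-after-start (plus v) (minus v) (plus-minus-same-circuit v) (distinct v) = refl
  ... | no v≢w rewrite stretch-step (plus v) (minus v) (plus w) (plus-minus-same-circuit v)
                         (passages-apart (≢-sym v≢w) (plus-at w) (plus-at v)) (passages-apart (≢-sym v≢w) (plus-at w) (minus-at v))
    = ℤP.+-inverseʳ (indicator (inStretch (plus v) (minus v) (plus w)))

  σ-minus-step : ∀ v w → σ v (e3 w) - σ v (e4 w) ≡ idM v w
  σ-minus-step v w rewrite σ-at v (minus w) | σ-at v (nextPos P (minus w)) with v Fin.≟ w
  ... | yes refl rewrite stretch-end (plus v) (minus v) (plus-minus-same-circuit v)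
                       | stretch-after-end (plus v) (minus v) (plus-minus-same-circuit v) (distinct v) = refl
  ... | no v≢w rewrite stretch-step (plus v) (minus v) (minus w) (plus-minus-same-circuit v)
                         (passages-apart (≢-sym v≢w) (minus-at w) (plus-at v)) (passages-apart (≢-sym v≢w) (minus-at w) (minus-at v))
    = ℤP.+-inverseʳ (indicator (inStretch (plus v) (minus v) (minus w)))

  σ-interlace : ∀ v w → σ v (e1 w) - σ v (e4 w) ≡ - interlace s v w
  σ-interlace v w rewrite σ-at v (plus w) | σ-at v (nextPos P (minus w)) with v Fin.≟ w
  ... | yes refl rewrite stretch-start (plus v) (minus v) (plus-minus-same-circuit v) (distinct v)
                       | stretch-after-end (plus v) (minus v) (plus-minus-same-circuit v) (distinct v) = refl
  ... | no v≢w rewrite stretch-step (plus v) (minus v) (minus w) (plus-minus-same-circuit v)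
                         (passages-apart (≢-sym v≢w) (minus-at w) (plus-at v)) (passages-apart (≢-sym v≢w) (minus-at w) (minus-at v))
    = stretch-interlace (plus v) (minus v) (plus w) (minus w) (plus-minus-same-circuit v) (plus-minus-same-circuit w) (distinct v)
        (passages-apart v≢w (plus-at v) (plus-at w)) (passages-apart v≢w (plus-at v) (minus-at w))
        (passages-apart v≢w (minus-at v) (plus-at w)) (passages-apart v≢w (minus-at v) (minus-at w))

∑≡sum : ∀ {n} (f : Fin n → ℤ) → ∑ f ≡ sum f
∑≡sum {zero}  f = refl
∑≡sum {suc n} f = cong (f zero +_) (∑≡sum (f ∘ suc))

∑-cong : ∀ {n} {f g : Fin n → ℤ} → (∀ i → f i ≡ g i) → ∑ f ≡ ∑ g
∑-cong {f = f} {g} f≗g = trans (∑≡sum f) (trans (sum-cong-≗ f≗g) (sym (∑≡sum g)))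

∑-*ˡ : ∀ {n} (c : ℤ) (f : Fin n → ℤ) → ∑ (λ k → c * f k) ≡ c * ∑ f
∑-*ˡ c f = trans (∑≡sum (λ k → c * f k)) (trans (sym (*-distribˡ-sum c f)) (cong (c *_) (sym (∑≡sum f))))

∑-*ʳ : ∀ {n} (c : ℤ) (f : Fin n → ℤ) → ∑ (λ k → f k * c) ≡ ∑ f * c
∑-*ʳ c f = trans (∑≡sum (λ k → f k * c)) (trans (sym (*-distribʳ-sum c f)) (cong (_* c) (sym (∑≡sum f))))

∑-neg : ∀ {n} (f : Fin n → ℤ) → ∑ (λ k → - f k) ≡ - ∑ f
∑-neg f = trans (∑-cong (λ k → sym (ℤP.-1*i≡-i (f k)))) (trans (∑-*ˡ -1ℤ f) (ℤP.-1*i≡-i (∑ f)))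

∑-sub : ∀ {n} (f g : Fin n → ℤ) → ∑ (λ k → f k - g k) ≡ ∑ f - ∑ g
∑-sub f g = begin
  ∑ (λ k → f k - g k)       ≡⟨ ∑≡sum (λ k → f k - g k) ⟩
  sum (λ k → f k - g k)     ≡⟨ ∑-distrib-+ f (λ k → - g k) ⟩
  sum f + sum (λ k → - g k) ≡⟨ cong₂ _+_ (∑≡sum f) (∑≡sum (λ k → - g k)) ⟨
  ∑ f + ∑ (λ k → - g k)     ≡⟨ cong (∑ f +_) (∑-neg g) ⟩
  ∑ f - ∑ g                 ∎
  where open ≡-Reasoning

∑-pick : ∀ {n} (f : Fin n → ℤ) (j : Fin n) → (∀ k → k ≢ j → f k ≡ 0ℤ) → ∑ f ≡ f j
∑-pick {suc n} f j off = begin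
  ∑ f
    ≡⟨ ∑≡sum f ⟩
  sum f
    ≡⟨ sum-remove f ⟩
  f j + sum (f ∘ punchIn j)
    ≡⟨ cong (f j +_) (sum-cong-≗ (λ k → off (punchIn j k) (punchInᵢ≢i j k))) ⟩
  f j + sum (replicate n 0ℤ)
    ≡⟨ cong (f j +_) (sum-replicate-zero n) ⟩
  f j + 0ℤ
    ≡⟨ ℤP.+-identityʳ (f j) ⟩
  f j ∎
  where open ≡-Reasoning

diag : ∀ {n} → (Fin n → ℤ) → Mat n
diag d i j = if does (i Fin.≟ j) then d i else 0ℤ

diag-on : ∀ {n} (d : Fin n → ℤ) i → diag d i i ≡ d i
diag-on d i = cong (λ b → if b then d i else 0ℤ) (dec-true (i Fin.≟ i) refl)

diag-off : ∀ {n} (d : Fin n → ℤ) {i j} → i ≢ j → diag d i j ≡ 0ℤ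
diag-off d {i} {j} i≢j = cong (λ b → if b then d i else 0ℤ) (dec-false (i Fin.≟ j) i≢j)

·-diagʳ : ∀ {n} (M : Mat n) (d : Fin n → ℤ) i j → (M · diag d) i j ≡ M i j * d j
·-diagʳ M d i j = trans (∑-pick _ j (λ k k≢j → trans (cong (M i k *_) (diag-off d k≢j)) (ℤP.*-zeroʳ (M i k))))
                       (cong (M i j *_) (diag-on d j))

diag-·ˡ : ∀ {n} (d : Fin n → ℤ) (M : Mat n) i j → (diag d · M) i j ≡ d i * M i j
diag-·ˡ d M i j = trans (∑-pick _ i (λ k k≢i → trans (cong (_* M k j) (diag-off d (≢-sym k≢i))) (ℤP.*-zeroˡ (M k j))))
                       (cong (_* M i j) (diag-on d i))

∑-*idM : ∀ {n} (f : Fin n → ℤ) (u : Fin n) → ∑ (λ v → f v * idM v u) ≡ f u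
∑-*idM f u = trans (∑-pick _ u (λ v v≢u → trans (cong (f v *_) (diag-off (λ _ → 1ℤ) v≢u)) (ℤP.*-zeroʳ (f v))))
                   (trans (cong (f u *_) (diag-on (λ _ → 1ℤ) u)) (ℤP.*-identityʳ (f u)))

SignVector : ∀ {n} → (Fin n → ℤ) → Set
SignVector d = ∀ i → d i * d i ≡ 1ℤ

conjugate-entry : ∀ {n} (d : Fin n → ℤ) (M : Mat n) i j → (diag d · M · diag d) i j ≡ d i * M i j * d j
conjugate-entry d M i j = trans (·-diagʳ (diag d · M) d i j) (cong (_* d j) (diag-·ˡ d M i j))

conjugate-idM : ∀ {n} (d : Fin n → ℤ) → SignVector d → ∀ i j → d i * idM i j * d j ≡ idM i j
conjugate-idM d sq i j with i Fin.≟ j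
... | yes refl = trans (cong (_* d i) (ℤP.*-identityʳ (d i))) (sq i)
... | no _     = trans (cong (_* d j) (ℤP.*-zeroʳ (d i))) (ℤP.*-zeroˡ (d j))

sandwich-inverse : ∀ {n} (d : Fin n → ℤ) → SignVector d → (A B : Mat n) →
  A · diag d · B · diag d ≈M idM → B · diag d · A · diag d ≈M idM →
  IsInverse (diag d · A · diag d) B × (A ≈M diag d · (diag d · A · diag d) · diag d)
sandwich-inverse {n} d sq A B ADBD≈I BDAD≈I = (left-inverse , right-inverse) , unconjugate
  where
  D N : Mat n
  D = diag d
  N = D · A · D
  open ≡-Reasoning

  -- (A D B)ᵢⱼ dⱼ = δᵢⱼ, hence dᵢ (A D B)ᵢⱼ = dᵢ δᵢⱼ dⱼ = δᵢⱼ
  left-inverse : N · B ≈M idM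
  left-inverse i j = begin
    (N · B) i j
      ≡⟨ ∑-cong (λ k → cong (_* B k j) (conjugate-entry d A i k)) ⟩
    ∑ (λ k → d i * A i k * d k * B k j)
      ≡⟨ ∑-cong (λ k → regroup (d i) (A i k) (d k) (B k j)) ⟩
    ∑ (λ k → d i * (A i k * d k * B k j))
      ≡⟨ ∑-*ˡ (d i) (λ k → A i k * d k * B k j) ⟩
    d i * ∑ (λ k → A i k * d k * B k j)
      ≡⟨ cong (d i *_) (∑-cong (λ k → cong (_* B k j) (·-diagʳ A d i k))) ⟨
    d i * (A · D · B) i j
      ≡⟨ cong (d i *_) (unit-right ((A · D · B) i j) (d j) (sq j)) ⟨
    d i * ((A · D · B) i j * d j * d j)
      ≡⟨ cong (λ x → d i * (x * d j)) (trans (sym (·-diagʳ (A · D · B) d i j)) (ADBD≈I i j)) ⟩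
    d i * (idM i j * d j)
      ≡⟨ ℤP.*-assoc (d i) (idM i j) (d j) ⟨
    d i * idM i j * d j
      ≡⟨ conjugate-idM d sq i j ⟩
    idM i j ∎
    where
    regroup : ∀ a x b y → a * x * b * y ≡ a * (x * b * y)
    regroup = solve-∀
    unit-right : ∀ x e → e * e ≡ 1ℤ → x * e * e ≡ x
    unit-right x e e² = trans (ℤP.*-assoc x e e) (trans (cong (x *_) e²) (ℤP.*-identityʳ x))

  -- Bᵢₖ (dₖ Aₖⱼ dⱼ) summed over k is the (i , j) entry of B D A D
  right-inverse : B · N ≈M idM
  right-inverse i j = begin
    (B · N) i j
      ≡⟨ ∑-cong (λ k → cong (B i k *_) (conjugate-entry d A k j)) ⟩
    ∑ (λ k → B i k * (d k * A k j * d j))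
      ≡⟨ ∑-cong (λ k → regroup (B i k) (d k) (A k j) (d j)) ⟩
    ∑ (λ k → B i k * d k * A k j * d j)
      ≡⟨ ∑-*ʳ (d j) (λ k → B i k * d k * A k j) ⟩
    ∑ (λ k → B i k * d k * A k j) * d j
      ≡⟨ cong (_* d j) (∑-cong (λ k → cong (_* A k j) (·-diagʳ B d i k))) ⟨
    (B · D · A) i j * d j
      ≡⟨ ·-diagʳ (B · D · A) d i j ⟨
    (B · D · A · D) i j
      ≡⟨ BDAD≈I i j ⟩
    idM i j ∎
    where
    regroup : ∀ b e a f → b * (e * a * f) ≡ b * e * a * f
    regroup = solve-∀

  unconjugate : A ≈M D · N · D
  unconjugate i j = sym (begin
    (D · N · D) i j                        ≡⟨ conjugate-entry d N i j ⟩
    d i * N i j * d j                      ≡⟨ cong (λ x → d i * x * d j) (conjugate-entry d A i j) ⟩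
    d i * (d i * A i j * d j) * d j        ≡⟨ regroup (d i) (A i j) (d j) ⟩
    d i * d i * A i j * (d j * d j)        ≡⟨ cong₂ (λ x y → x * A i j * y) (sq i) (sq j) ⟩
    1ℤ * A i j * 1ℤ                        ≡⟨ trans (ℤP.*-identityʳ _) (ℤP.*-identityˡ (A i j)) ⟩
    A i j                                  ∎)
    where
    regroup : ∀ a x b → a * (a * x * b) * b ≡ a * a * x * (b * b)
    regroup = solve-∀

diag-signDiagonal : ∀ {n} (d : Fin n → ℤ) → (∀ i → d i ≡ 1ℤ ⊎ d i ≡ -1ℤ) → IsSignDiagonal (diag d)
diag-signDiagonal d ±1 = (λ i → subst (λ x → x ≡ 1ℤ ⊎ x ≡ -1ℤ) (sym (diag-on d i)) (±1 i)) , (λ i j → diag-off d)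

module Potential {n m : ℕ} (F : Graph n m) (reg : FourRegular F) (A : EulerSystem F) (s : Signing A) where
  open Signing s
  open Segments F reg A s public

  Balanced : (Fin m → ℤ) → Set
  Balanced z = ∀ u → z (e1 u) + z (e3 u) ≡ z (e2 u) + z (e4 u)

  σ-balanced : ∀ v → Balanced (σ v)
  σ-balanced v u = balance (σ v (e1 u)) (σ v (e2 u)) (σ v (e3 u)) (σ v (e4 u)) (idM v u) (σ-plus-step v u) (σ-minus-step v u)
    where
    balance : ∀ a b c d i → a - b ≡ - i → c - d ≡ i → a + c ≡ b + d
    balance a b c d i ab cd = ℤP.i-j≡0⇒i≡j (a + c) (b + d) (begin
      a + c - (b + d)     ≡⟨ regroup a b c d ⟩
      (a - b) + (c - d)   ≡⟨ cong₂ _+_ ab cd ⟩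
      - i + i             ≡⟨ ℤP.+-inverseˡ i ⟩
      0ℤ                  ∎)
      where
      open ≡-Reasoning
      regroup : ∀ a b c d → a + c - (b + d) ≡ (a - b) + (c - d)
      regroup = solve-∀

  jump : (Fin m → ℤ) → Fin n → ℤ
  jump z v = z (e1 v) - z (e2 v)

  potential : (Fin m → ℤ) → Fin m → ℤ
  potential z e = z e + ∑ (λ v → jump z v * σ v e)

  module _ (z : Fin m → ℤ) where

    potential-diff : ∀ e e′ → potential z e - potential z e′ ≡ (z e - z e′) + ∑ (λ v → jump z v * (σ v e - σ v e′))
    potential-diff e e′ = begin
      potential z e - potential z e′
        ≡⟨ regroup (z e) (z e′) (∑ (λ v → jump z v * σ v e)) (∑ (λ v → jump z v * σ v e′)) ⟩
      (z e - z e′) + (∑ (λ v → jump z v * σ v e) - ∑ (λ v → jump z v * σ v e′))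
        ≡⟨ cong ((z e - z e′) +_) (∑-sub (λ v → jump z v * σ v e) (λ v → jump z v * σ v e′)) ⟨
      (z e - z e′) + ∑ (λ v → jump z v * σ v e - jump z v * σ v e′)
        ≡⟨ cong ((z e - z e′) +_) (∑-cong (λ v → distrib (jump z v) (σ v e) (σ v e′))) ⟨
      (z e - z e′) + ∑ (λ v → jump z v * (σ v e - σ v e′)) ∎
      where
      open ≡-Reasoning
      regroup : ∀ a b c d → (a + c) - (b + d) ≡ (a - b) + (c - d)
      regroup = solve-∀
      distrib : ∀ a b c → a * (b - c) ≡ a * b - a * c
      distrib = solve-∀

    -- The potential is continuous at v⁺ (by construction of the jumps) …
    potential-plus : ∀ u → potential z (e1 u) ≡ potential z (e2 u)
    potential-plus u = ℤP.i-j≡0⇒i≡j _ _ (begin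
      potential z (e1 u) - potential z (e2 u)
        ≡⟨ potential-diff (e1 u) (e2 u) ⟩
      jump z u + ∑ (λ v → jump z v * (σ v (e1 u) - σ v (e2 u)))
        ≡⟨ cong (jump z u +_) (∑-cong (λ v → cong (jump z v *_) (σ-plus-step v u))) ⟩
      jump z u + ∑ (λ v → jump z v * - idM v u)
        ≡⟨ cong (jump z u +_) (∑-cong (λ v → sym (ℤP.neg-distribʳ-* (jump z v) (idM v u)))) ⟩
      jump z u + ∑ (λ v → - (jump z v * idM v u))
        ≡⟨ cong (jump z u +_) (trans (∑-neg (λ v → jump z v * idM v u)) (cong -_ (∑-*idM (jump z) u))) ⟩
      jump z u - jump z u
        ≡⟨ ℤP.+-inverseʳ (jump z u) ⟩
      0ℤ ∎)
      where open ≡-Reasoning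

  module _ (z : Fin m → ℤ) (balanced : Balanced z) where

    -- … and at v⁻ (by balance) …
    potential-minus : ∀ u → potential z (e3 u) ≡ potential z (e4 u)
    potential-minus u = ℤP.i-j≡0⇒i≡j _ _ (begin
      potential z (e3 u) - potential z (e4 u)
        ≡⟨ potential-diff z (e3 u) (e4 u) ⟩
      (z (e3 u) - z (e4 u)) + ∑ (λ v → jump z v * (σ v (e3 u) - σ v (e4 u)))
        ≡⟨ cong ((z (e3 u) - z (e4 u)) +_) (∑-cong (λ v → cong (jump z v *_) (σ-minus-step v u))) ⟩
      (z (e3 u) - z (e4 u)) + ∑ (λ v → jump z v * idM v u)
        ≡⟨ cong ((z (e3 u) - z (e4 u)) +_) (∑-*idM (jump z) u) ⟩
      (z (e3 u) - z (e4 u)) + (z (e1 u) - z (e2 u))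
        ≡⟨ regroup (z (e1 u)) (z (e2 u)) (z (e3 u)) (z (e4 u)) ⟩
      (z (e1 u) + z (e3 u)) - (z (e2 u) + z (e4 u))
        ≡⟨ ℤP.i≡j⇒i-j≡0 (balanced u) ⟩
      0ℤ ∎)
      where
      open ≡-Reasoning
      regroup : ∀ a b c d → (c - d) + (a - b) ≡ (a + c) - (b + d)
      regroup = solve-∀

    -- … hence constant along every step of A, as each step arrives at some v⁺ or v⁻.
    potential-step : ∀ p → potential z (edgeAt P (nextPos P p)) ≡ potential z (edgeAt P p)
    potential-step p with passages (passVertex P p) p refl
    ... | inj₁ p≡plus  = subst (λ q → potential z (edgeAt P (nextPos P q)) ≡ potential z (edgeAt P q)) (sym p≡plus)
                               (sym (potential-plus z (passVertex P p)))
    ... | inj₂ p≡minus = subst (λ q → potential z (edgeAt P (nextPos P q)) ≡ potential z (edgeAt P q)) (sym p≡minus)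
                               (sym (potential-minus (passVertex P p)))

    -- In particular it agrees on e1 w and e4 w, which lie on the same circuit.
    potential-e1≡e4 : ∀ w → potential z (e1 w) ≡ potential z (e4 w)
    potential-e1≡e4 w = trans (constant-on-circuit P (potential z ∘ edgeAt P) potential-step (plus w) (minus w)
                                 (plus-minus-same-circuit w))
                              (potential-minus w)

    jump-sum : ∀ w g → g ≡ e2 w ⊎ g ≡ e4 w →
      ∑ (λ v → jump z v * (σ v (e1 w) - σ v g)) ≡ - (z (e1 w) - z g)
    jump-sum w g g-exit = inverseʳ-unique (z (e1 w) - z g) _ (begin
      (z (e1 w) - z g) + ∑ (λ v → jump z v * (σ v (e1 w) - σ v g)) ≡⟨ potential-diff z (e1 w) g ⟨
      potential z (e1 w) - potential z g                            ≡⟨ ℤP.i≡j⇒i-j≡0 (level g-exit) ⟩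
      0ℤ                                                            ∎)
      where
      open ≡-Reasoning
      level : g ≡ e2 w ⊎ g ≡ e4 w → potential z (e1 w) ≡ potential z g
      level (inj₁ refl) = potential-plus z w
      level (inj₂ refl) = potential-e1≡e4 w

module Transitions {n m : ℕ} (F : Graph n m) (reg : FourRegular F) (A : EulerSystem F) (s : Signing A)
                   (Q : Circuits F) (cpQ : IsCircuitPartition Q) (sd : SameDirections (circs A) Q) where
  open Signing s
  open Potential F reg A s
  open IsCircuitPartition cpQ using (once)

  sd⁻¹ : SameDirections Q P
  sd⁻¹ = sameDirections-sym {X = P} {Y = Q} sd

  matching : Pos P → Pos Q
  matching p = positionOf Q cpQ (edgeAt P p)

  matching-edge : ∀ p → edgeAt Q (matching p) ≡ edgeAt P p
  matching-edge p = proj₂ (IsCircuitPartition.covers cpQ (edgeAt P p))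

  matching-arrival : ∀ p → inHalf Q (matching p) ≡ inHalf P p
  matching-arrival p = cong₂ (λ e d → (e , not d)) (matching-edge p) (sym (sd p (matching p) (sym (matching-edge p))))

  matching-unique : ∀ p q → inHalf Q q ≡ inHalf P p → q ≡ matching p
  matching-unique p q same = once q (matching p) (trans (cong proj₁ same) (sym (matching-edge p)))

  outHalf-injective : ∀ q q′ → outHalf Q q ≡ outHalf Q q′ → q ≡ q′
  outHalf-injective q q′ same = nextPos-injective Q q q′ (once _ _ (cong proj₁ same))

  entry⁺ entry⁻ : Fin n → Pos Q
  entry⁺ w = matching (plus w)
  entry⁻ w = matching (minus w)

  entry⁺-at : ∀ w → passVertex Q (entry⁺ w) ≡ w
  entry⁺-at w = trans (cong (end F) (matching-arrival (plus w))) (plus-at w)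

  entry⁻-at : ∀ w → passVertex Q (entry⁻ w) ≡ w
  entry⁻-at w = trans (cong (end F) (matching-arrival (minus w))) (minus-at w)

  entry⁺≢entry⁻ : ∀ w → entry⁺ w ≢ entry⁻ w
  entry⁺≢entry⁻ w same = h1≢h3 w
    (trans (sym (matching-arrival (plus w))) (trans (cong (inHalf Q) same) (matching-arrival (minus w))))

  departure : ∀ w q → passVertex Q q ≡ w → outHalf Q q ≡ h2 s w ⊎ outHalf Q q ≡ h4 s w
  departure = departure-corner Q sd

  exit : Fin n → Fin m
  exit w = proj₁ (outHalf Q (entry⁺ w))

  exit-corner : ∀ w → exit w ≡ e2 w ⊎ exit w ≡ e4 w
  exit-corner w with departure w (entry⁺ w) (entry⁺-at w)
  ... | inj₁ eq = inj₁ (cong proj₁ eq)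
  ... | inj₂ eq = inj₂ (cong proj₁ eq)

  exits-sum : ∀ w (z : Fin m → ℤ) → z (e2 w) + z (e4 w) ≡ z (exit w) + z (proj₁ (outHalf Q (entry⁻ w)))
  exits-sum w z with departure w (entry⁺ w) (entry⁺-at w) | departure w (entry⁻ w) (entry⁻-at w)
  ... | inj₁ a | inj₁ b = ⊥-elim (entry⁺≢entry⁻ w (outHalf-injective (entry⁺ w) (entry⁻ w) (trans a (sym b))))
  ... | inj₁ a | inj₂ b rewrite a | b = refl
  ... | inj₂ a | inj₁ b rewrite a | b = ℤP.+-comm (z (e2 w)) (z (e4 w))
  ... | inj₂ a | inj₂ b = ⊥-elim (entry⁺≢entry⁻ w (outHalf-injective (entry⁺ w) (entry⁻ w) (trans a (sym b))))

  φ-from-exit : ∀ w → outHalf Q (entry⁺ w) ≡ h2 s w → TransitionIs Q w (φ s w)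
  φ-from-exit w exit-h2 q q-at with arrival-corner Q sd⁻¹ w q q-at | departure w q q-at
  ... | inj₁ in-h1 | _ rewrite matching-unique (plus w) q in-h1 = inj₁ (inj₁ (matching-arrival (plus w) , exit-h2))
  ... | inj₂ in-h3 | inj₁ out-h2 = ⊥-elim (entry⁺≢entry⁻ w
          (trans (sym (outHalf-injective q (entry⁺ w) (trans out-h2 (sym exit-h2)))) (matching-unique (minus w) q in-h3)))
  ... | inj₂ in-h3 | inj₂ out-h4 = inj₂ (inj₁ (in-h3 , out-h4))

  exit-φ : ∀ w → TransitionIs Q w (φ s w) → exit w ≡ e2 w
  exit-φ w t with t (entry⁺ w) (entry⁺-at w)
  ... | inj₁ (inj₁ (_ , out-h2)) = cong proj₁ out-h2
  ... | inj₁ (inj₂ (in-h2 , _))  = ⊥-elim (arrive≢depart Q P sd⁻¹ (entry⁺ w) (nextPos P (plus w)) in-h2)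
  ... | inj₂ (inj₁ (in-h3 , _))  = ⊥-elim (h1≢h3 w (trans (sym (matching-arrival (plus w))) in-h3))
  ... | inj₂ (inj₂ (in-h4 , _))  = ⊥-elim (arrive≢depart Q P sd⁻¹ (entry⁺ w) (nextPos P (minus w)) in-h4)

  exit-¬φ : ∀ w → ¬ TransitionIs Q w (φ s w) → exit w ≡ e4 w
  exit-¬φ w not-φ with departure w (entry⁺ w) (entry⁺-at w)
  ... | inj₁ out-h2 = ⊥-elim (not-φ (φ-from-exit w out-h2))
  ... | inj₂ out-h4 = cong proj₁ out-h4

  M0-formula : ∀ v w → M0 s Q v w ≡ - (σ v (e1 w) - σ v (exit w))
  M0-formula v w = by-cases (transitionIs? Q w (φ s w))
    where
    open ≡-Reasoning
    by-cases : (d : Dec (TransitionIs Q w (φ s w))) →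
      (if does d then idM v w else interlace s v w) ≡ - (σ v (e1 w) - σ v (exit w))
    by-cases (yes is-φ) = begin
      idM v w                         ≡⟨ ℤP.neg-involutive (idM v w) ⟨
      - - idM v w                     ≡⟨ cong -_ (σ-plus-step v w) ⟨
      - (σ v (e1 w) - σ v (e2 w))     ≡⟨ cong (λ g → - (σ v (e1 w) - σ v g)) (exit-φ w is-φ) ⟨
      - (σ v (e1 w) - σ v (exit w))   ∎
    by-cases (no not-φ) = begin
      interlace s v w                 ≡⟨ ℤP.neg-involutive (interlace s v w) ⟨
      - - interlace s v w             ≡⟨ cong -_ (σ-interlace v w) ⟨
      - (σ v (e1 w) - σ v (e4 w))     ≡⟨ cong (λ g → - (σ v (e1 w) - σ v g)) (exit-¬φ w not-φ) ⟨
      - (σ v (e1 w) - σ v (exit w))   ∎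

samePair-sum : ∀ {m} {a b c d : HalfEdge m} (f : HalfEdge m → ℤ) →
  SamePair (a , b) (c , d) → f a + f b ≡ f c + f d
samePair-sum f (inj₁ (refl , refl)) = refl
samePair-sum f (inj₂ (refl , refl)) = ℤP.+-comm (f _) (f _)

module SelfTransitions {n m : ℕ} (F : Graph n m) (reg : FourRegular F) (A : EulerSystem F) (s : Signing A) where
  open Signing s
  open Potential F reg A s
  open Transitions F reg A s P cpA (sameDirections-refl P cpA)

  exit-self : ∀ w → exit w ≡ e2 w
  exit-self w = cong (λ p → proj₁ (outHalf P p)) (positionOf-edgeAt P cpA (plus w))

  M0-self : M0 s P ≈M idM
  M0-self v w = begin
    M0 s P v w                      ≡⟨ M0-formula v w ⟩
    - (σ v (e1 w) - σ v (exit w))   ≡⟨ cong (λ g → - (σ v (e1 w) - σ v g)) (exit-self w) ⟩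
    - (σ v (e1 w) - σ v (e2 w))     ≡⟨ cong -_ (σ-plus-step v w) ⟩
    - - idM v w                     ≡⟨ ℤP.neg-involutive (idM v w) ⟩
    idM v w                         ∎
    where open ≡-Reasoning

module Comparison {n m : ℕ} (F : Graph n m) (reg : FourRegular F)
                  (A : EulerSystem F) (sA : Signing A) (B : EulerSystem F) (sB : Signing B)
                  (sdAB : SameDirections (circs A) (circs B)) where
  module PA = Potential F reg A sA
  module PB = Potential F reg B sB

  sdBA : SameDirections (circs B) (circs A)
  sdBA = sameDirections-sym {X = circs A} {Y = circs B} sdAB

  entries-agree : ∀ w → SamePair (h1 sB w , h3 sB w) (h1 sA w , h3 sA w)
  entries-agree w with PA.arrival-corner (circs B) sdBA w (Signing.plus sB w) (Signing.plus-at sB w)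
                     | PA.arrival-corner (circs B) sdBA w (Signing.minus sB w) (Signing.minus-at sB w)
  ... | inj₁ a | inj₁ b = ⊥-elim (PB.h1≢h3 w (trans a (sym b)))
  ... | inj₁ a | inj₂ b = inj₁ (a , b)
  ... | inj₂ a | inj₁ b = inj₂ (a , b)
  ... | inj₂ a | inj₂ b = ⊥-elim (PB.h1≢h3 w (trans a (sym b)))

  exits-agree : ∀ w → SamePair (h2 sB w , h4 sB w) (h2 sA w , h4 sA w)
  exits-agree w with PA.departure-corner (circs B) sdAB w (Signing.plus sB w) (Signing.plus-at sB w)
                   | PA.departure-corner (circs B) sdAB w (Signing.minus sB w) (Signing.minus-at sB w)
  ... | inj₁ a | inj₁ b = ⊥-elim (PB.h2≢h4 w (trans a (sym b)))
  ... | inj₁ a | inj₂ b = inj₁ (a , b)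
  ... | inj₂ a | inj₁ b = inj₂ (a , b)
  ... | inj₂ a | inj₂ b = ⊥-elim (PB.h2≢h4 w (trans a (sym b)))

  balanced-transfer : ∀ z → PB.Balanced z → PA.Balanced z
  balanced-transfer z balanced u = begin
    z (PA.e1 u) + z (PA.e3 u)   ≡⟨ samePair-sum (z ∘ proj₁) (entries-agree u) ⟨
    z (PB.e1 u) + z (PB.e3 u)   ≡⟨ balanced u ⟩
    z (PB.e2 u) + z (PB.e4 u)   ≡⟨ samePair-sum (z ∘ proj₁) (exits-agree u) ⟩
    z (PA.e2 u) + z (PA.e4 u)   ∎
    where open ≡-Reasoning

  RelativeSign : (Fin n → ℤ) → Set
  RelativeSign d = ∀ w → (h1 sB w ≡ h1 sA w → d w ≡ 1ℤ) × (h1 sB w ≡ h3 sA w → d w ≡ -1ℤ)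

  sign : Fin n → ℤ
  sign w = if does (h1 sA w ≟H h1 sB w) then 1ℤ else -1ℤ

  sign-relative : RelativeSign sign
  sign-relative w =
    (λ agree → cong (λ b → if b then 1ℤ else -1ℤ) (dec-true (h1 sA w ≟H h1 sB w) (sym agree))) ,
    (λ cross → cong (λ b → if b then 1ℤ else -1ℤ) (dec-false (h1 sA w ≟H h1 sB w) (λ e → PA.h1≢h3 w (trans e cross))))

  relative-swap : ∀ {d} → RelativeSign d →
    ∀ w → (h1 sA w ≡ h1 sB w → d w ≡ 1ℤ) × (h1 sA w ≡ h3 sB w → d w ≡ -1ℤ)
  relative-swap {d} rel w = (λ agree → proj₁ (rel w) (sym agree)) , cross
    where
    cross : h1 sA w ≡ h3 sB w → d w ≡ -1ℤ
    cross e with entries-agree w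
    ... | inj₁ (_ , h3-agree) = ⊥-elim (PA.h1≢h3 w (trans e h3-agree))
    ... | inj₂ (h1-cross , _) = proj₂ (rel w) h1-cross

  relative-±1 : ∀ {d} → RelativeSign d → ∀ w → d w ≡ 1ℤ ⊎ d w ≡ -1ℤ
  relative-±1 rel w with entries-agree w
  ... | inj₁ (agree , _) = inj₁ (proj₁ (rel w) agree)
  ... | inj₂ (cross , _) = inj₂ (proj₂ (rel w) cross)

  module _ {d : Fin n → ℤ} (rel : RelativeSign d) where

    module _ (Q : Circuits F) (cpQ : IsCircuitPartition Q)
             (sdAQ : SameDirections (circs A) Q) (sdBQ : SameDirections (circs B) Q) where
      private
        module TA = Transitions F reg A sA Q cpQ sdAQ
        module TB = Transitions F reg B sB Q cpQ sdBQ

      exit-change : ∀ z → PA.Balanced z → ∀ w →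
        z (PB.e1 w) - z (TB.exit w) ≡ d w * (z (PA.e1 w) - z (TA.exit w))
      exit-change z balanced w with entries-agree w
      ... | inj₁ (agree , _) = begin
        z (PB.e1 w) - z (TB.exit w)
          ≡⟨ cong₂ (λ e q → z e - z (proj₁ (outHalf Q q))) (cong proj₁ agree) same-entry ⟩
        z (PA.e1 w) - z (TA.exit w)
          ≡⟨ ℤP.*-identityˡ _ ⟨
        1ℤ * (z (PA.e1 w) - z (TA.exit w))
          ≡⟨ cong (_* (z (PA.e1 w) - z (TA.exit w))) (proj₁ (rel w) agree) ⟨
        d w * (z (PA.e1 w) - z (TA.exit w)) ∎
        where
        open ≡-Reasoning
        same-entry : TB.entry⁺ w ≡ TA.entry⁺ w
        same-entry = TA.matching-unique (Signing.plus sA w) (TB.entry⁺ w) (trans (TB.matching-arrival (Signing.plus sB w)) agree)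
      ... | inj₂ (cross , _) = begin
        z (PB.e1 w) - z (TB.exit w)
          ≡⟨ cong₂ (λ e q → z e - z (proj₁ (outHalf Q q))) (cong proj₁ cross) swapped-entry ⟩
        z (PA.e3 w) - z (exit⁻)
          ≡⟨ opposite (z (PA.e1 w)) (z (PA.e3 w)) (z (TA.exit w)) (z exit⁻) (trans (balanced w) (TA.exits-sum w z)) ⟩
        -1ℤ * (z (PA.e1 w) - z (TA.exit w))
          ≡⟨ cong (_* (z (PA.e1 w) - z (TA.exit w))) (proj₂ (rel w) cross) ⟨
        d w * (z (PA.e1 w) - z (TA.exit w)) ∎
        where
        open ≡-Reasoning
        exit⁻ : Fin m
        exit⁻ = proj₁ (outHalf Q (TA.entry⁻ w))
        swapped-entry : TB.entry⁺ w ≡ TA.entry⁻ w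
        swapped-entry = TA.matching-unique (Signing.minus sA w) (TB.entry⁺ w) (trans (TB.matching-arrival (Signing.plus sB w)) cross)
        opposite : ∀ a c p q → a + c ≡ p + q → c - q ≡ -1ℤ * (a - p)
        opposite a c p q sums = begin
          c - q                                          ≡⟨ regroup a c p q ⟩
          ((a + c) - (p + q)) + -1ℤ * (a - p)            ≡⟨ cong (_+ -1ℤ * (a - p)) (ℤP.i≡j⇒i-j≡0 sums) ⟩
          0ℤ + -1ℤ * (a - p)                             ≡⟨ ℤP.+-identityˡ _ ⟩
          -1ℤ * (a - p)                                  ∎
          where
          regroup : ∀ a c p q → c - q ≡ ((a + c) - (p + q)) + -1ℤ * (a - p)
          regroup = solve-∀

    relative-square : SignVector d
    relative-square w with relative-±1 rel w
    ... | inj₁ d≡1  rewrite d≡1  = refl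
    ... | inj₂ d≡-1 rewrite d≡-1 = refl

    M0-across : ∀ x v → M0 sB (circs A) x v ≡ - (d v * PA.jump (PB.σ x) v)
    M0-across x v = begin
      M0 sB (circs A) x v
        ≡⟨ TBA.M0-formula x v ⟩
      - (z (PB.e1 v) - z (TBA.exit v))
        ≡⟨ cong -_ (exit-change (circs A) PA.cpA selfA sdBA z z-balanced v) ⟩
      - (d v * (z (PA.e1 v) - z (TAA.exit v)))
        ≡⟨ cong (λ g → - (d v * (z (PA.e1 v) - z g))) (SelfTransitions.exit-self F reg A sA v) ⟩
      - (d v * PA.jump z v) ∎
      where
      open ≡-Reasoning
      selfA : SameDirections (circs A) (circs A)
      selfA = sameDirections-refl (circs A) PA.cpA
      module TAA = Transitions F reg A sA (circs A) PA.cpA selfA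
      module TBA = Transitions F reg B sB (circs A) PA.cpA sdBA
      z : Fin m → ℤ
      z = PB.σ x
      z-balanced : PA.Balanced z
      z-balanced = balanced-transfer z (PB.σ-balanced x)

    M0-product : ∀ Q (cpQ : IsCircuitPartition Q) (sdAQ : SameDirections (circs A) Q) (sdBQ : SameDirections (circs B) Q) →
      M0 sB Q ≈M M0 sB (circs A) · diag d · M0 sA Q · diag d
    M0-product Q cpQ sdAQ sdBQ x w = sym (begin
      (M0BA · diag d · M0AQ · diag d) x w
        ≡⟨ ·-diagʳ (M0BA · diag d · M0AQ) d x w ⟩
      (M0BA · diag d · M0AQ) x w * d w
        ≡⟨ cong (_* d w) (∑-cong term) ⟩
      ∑ (λ v → PA.jump z v * change v) * d w
        ≡⟨ cong (_* d w) (PA.jump-sum z z-balanced w (TA.exit w) (TA.exit-corner w)) ⟩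
      - (z (PA.e1 w) - z (TA.exit w)) * d w
        ≡⟨ neg-swap (z (PA.e1 w) - z (TA.exit w)) (d w) ⟩
      - (d w * (z (PA.e1 w) - z (TA.exit w)))
        ≡⟨ cong -_ (exit-change Q cpQ sdAQ sdBQ z z-balanced w) ⟨
      - (z (PB.e1 w) - z (TB.exit w))
        ≡⟨ TB.M0-formula x w ⟨
      M0 sB Q x w ∎)
      where
      open ≡-Reasoning
      module TA = Transitions F reg A sA Q cpQ sdAQ
      module TB = Transitions F reg B sB Q cpQ sdBQ
      M0BA M0AQ : Mat n
      M0BA = M0 sB (circs A)
      M0AQ = M0 sA Q
      z : Fin m → ℤ
      z = PB.σ x
      z-balanced : PA.Balanced z
      z-balanced = balanced-transfer z (PB.σ-balanced x)
      neg-swap : ∀ a b → - a * b ≡ - (b * a)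
      neg-swap = solve-∀
      change : Fin n → ℤ
      change v = PA.σ v (PA.e1 w) - PA.σ v (TA.exit w)
      cancel : ∀ e j g → - (e * j) * e * - g ≡ j * g * (e * e)
      cancel = solve-∀
      term : ∀ v → (M0BA · diag d) x v * M0AQ v w ≡ PA.jump z v * change v
      term v = begin
        (M0BA · diag d) x v * M0AQ v w
          ≡⟨ cong₂ _*_ (trans (·-diagʳ M0BA d x v) (cong (_* d v) (M0-across x v))) (TA.M0-formula v w) ⟩
        - (d v * PA.jump z v) * d v * - change v
          ≡⟨ cancel (d v) (PA.jump z v) (change v) ⟩
        PA.jump z v * change v * (d v * d v)
          ≡⟨ cong (PA.jump z v * change v *_) (relative-square v) ⟩
        PA.jump z v * change v * 1ℤ
          ≡⟨ ℤP.*-identityʳ (PA.jump z v * change v) ⟩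
        PA.jump z v * change v ∎

-- The corollary, with Δ = diag sign: the main identity for Q = C′, and with the roles of C and C′
-- exchanged for Q = C, gives M⁰(C′,C) Δ M⁰(C,C′) Δ = I = M⁰(C,C′) Δ M⁰(C′,C) Δ, so
-- Δ M⁰(C′,C) Δ inverts M⁰(C,C′) (sandwich-inverse); for Q = P it is the last claim.
corollary21 : ∀ {n m} (F : Graph n m) → FourRegular F →
    (C C′ : EulerSystem F) → SameDirections (circs C) (circs C′) →
    (s : Signing C) (s′ : Signing C′) →
    Σ (Mat n) λ Δ →
      IsSignDiagonal Δ ×
      (Σ (Mat n) λ N →
         IsInverse N (M0 s (circs C′)) × (M0 s′ (circs C) ≈M Δ · N · Δ)) ×
      ((P : CircuitPartition F) →
         SameDirections (circs C) (circuits P) →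
         SameDirections (circs C′) (circuits P) →
         M0 s′ (circuits P) ≈M M0 s′ (circs C) · Δ · M0 s (circuits P) · Δ)
corollary21 {n} F reg C C′ sd s s′ =
  diag sign , diag-signDiagonal sign (relative-±1 sign-relative) ,
  (diag sign · M′ · diag sign , sandwich-inverse sign (relative-square sign-relative) M′ M M′ΔMΔ≈I MΔM′Δ≈I) ,
  λ P sdCP sdC′P → M0-product sign-relative (circuits P) (CircuitPartition.isCP P) sdCP sdC′P
  where
  open Comparison F reg C s C′ s′ sd
  module Backwards = Comparison F reg C′ s′ C s sdBA
  cpC : IsCircuitPartition (circs C)
  cpC = CircuitPartition.isCP (partition C)
  cpC′ : IsCircuitPartition (circs C′)
  cpC′ = CircuitPartition.isCP (partition C′)
  M M′ : Mat n
  M  = M0 s (circs C′)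
  M′ = M0 s′ (circs C)

  M′ΔMΔ≈I : M′ · diag sign · M · diag sign ≈M idM
  M′ΔMΔ≈I i j = trans (sym (M0-product sign-relative (circs C′) cpC′ sd (sameDirections-refl (circs C′) cpC′) i j))
                      (SelfTransitions.M0-self F reg C′ s′ i j)

  MΔM′Δ≈I : M · diag sign · M′ · diag sign ≈M idM
  MΔM′Δ≈I i j = trans (sym (Backwards.M0-product (relative-swap sign-relative) (circs C) cpC sdBA (sameDirections-refl (circs C) cpC) i j))
                      (SelfTransitions.M0-self F reg C s i j)
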